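{- Let $G_1,\dots,G_n$ be a recursive family of regular graphs as described in the context, with $n\ge 2$, and write $G_n=G_{n-1}^1\oplus\cdots\oplus G_{n-1}^{p_n}$. Let $2\le l\le p_n-1$, let $i_1,\dots,i_l$ be distinct indices in $\{1,\dots,p_n\}$, and let $H=G_{n-1}^{i_1}\oplus\cdots\oplus G_{n-1}^{i_l}$ be the subgraph of $G_n$ induced by $\bigcup_{m=1}^{l}V(G_{n-1}^{i_m})$. Then $\kappa(H)\ge r+2(n-2)$ (where $r+2(n-2)\ge 4$).
   Context: $\kappa(H)$ denotes the (vertex) connectivity of $H$. Recursive family: $r,a\ge1$ are integers and $p_2,p_3,\dots$ are positive integers. $G_1$ is an $r$-regular, $r$-connected graph with $a$ vertices. For each $t$ with $2\le t\le n$, $G_t$ is a regular graph whose vertex set is partitioned into $p_t$ parts, each inducing a copy of $G_{t-1}$; these copies are denoted $G_{t-1}^1,\dots,G_{t-1}^{p_t}$ and we write $G_t=G_{t-1}^1\oplus\cdots\oplus G_{t-1}^{p_t}$. The following hold for each such $t$: (i) every vertex $u$ of a copy $G_{t-1}^i$ has exactly two neighbours outside $G_{t-1}^i$ (its outside neighbours), and these two outside neighbours lie in two different copies $G_{t-1}^j,G_{t-1}^{j'}$ with $j\neq j'$; (ii) the number of edges between $G_{t-1}^i$ and $G_{t-1}^j$ is the same number $e_t$ for all $i\neq j$; (iii) $e_t\ge r+2(t-2)+2$ and $r+2(t-2)\ge 4$; (iv) $G_t$ is $m$-regular and $m$-connected, where $m=r+2(t-1)$. -}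

module Defs where

open import Data.Nat using (ℕ; zero; suc; _+_; _*_; _∸_; _≤_; _<_)
open import Data.Bool using (Bool; true; false; if_then_else_; _∧_; not; T)
open import Data.Fin using (Fin; zero; suc; combine; quotient)
open import Data.Product using (Σ; ∃; _×_; _,_)
open import Data.Sum using (_⊎_)
open import Relation.Binary.PropositionalEquality using (_≡_; _≢_)

sumF : ∀ {n} → (Fin n → ℕ) → ℕ
sumF {zero}  f = 0
sumF {suc n} f = f zero + sumF (λ x → f (suc x))

count : ∀ {n} → (Fin n → Bool) → ℕ
count S = sumF (λ x → if S x then 1 else 0)

record Graph (N : ℕ) : Set where
  field
    adj    : Fin N → Fin N → Bool
    sym    : ∀ u v → adj u v ≡ adj v u
    irrefl : ∀ u → adj u u ≡ false
open Graph public

degree : ∀ {N} → Graph N → Fin N → ℕ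
degree G u = count (adj G u)

Regular : ∀ {N} → ℕ → Graph N → Set
Regular k G = ∀ u → degree G u ≡ k

data Walk {N : ℕ} (G : Graph N) (W : Fin N → Bool) : Fin N → Fin N → Set where
  here : ∀ u → T (W u) → Walk G W u u
  step : ∀ u v w → T (W u) → T (adj G u v) → Walk G W v w → Walk G W u w

ConnectedOn : ∀ {N} → Graph N → (Fin N → Bool) → Set
ConnectedOn G W = ∀ u v → T (W u) → T (W v) → Walk G W u v

-- κ(G[W]) ≥ k : G[W] has more than k vertices, and deleting any set of
-- fewer than k vertices leaves the induced subgraph connected.
KConnectedOn : ∀ {N} → ℕ → Graph N → (Fin N → Bool) → Set
KConnectedOn k G W =
  (k < count W) ×
  (∀ (S : Fin _ → Bool) → count S < k → ConnectedOn G (λ x → W x ∧ not (S x)))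

allV : ∀ {N} → Fin N → Bool
allV _ = true

KConnected : ∀ {N} → ℕ → Graph N → Set
KConnected k G = KConnectedOn k G allV

-- Number of vertices of G_t (levels t ≥ 1; index 0 is unused junk = a).
Size : ℕ → (ℕ → ℕ) → ℕ → ℕ
Size a p zero          = a
Size a p (suc zero)    = a
Size a p (suc (suc k)) = p (suc (suc k)) * Size a p (suc k)

-- Structure conditions for level t = k + 2, with G_t on Fin (p_t * |V(G_{t-1})|):
-- vertex `combine i u` is the copy of vertex u of G_{t-1} in the i-th part G_{t-1}^i.
module _ (P M : ℕ) (Gt : Graph (P * M)) (Gp : Graph M) where

  copyOf : Fin (P * M) → Fin P
  copyOf = quotient {P} M

  PartsAreCopies : Set
  PartsAreCopies = ∀ i u v → adj Gt (combine {P} i u) (combine {P} i v) ≡ adj Gp u v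

  OutsideNbr : Fin (P * M) → Fin (P * M) → Set
  OutsideNbr x w = T (adj Gt x w) × (copyOf w ≢ copyOf x)

  TwoOutside : Set
  TwoOutside = ∀ x → Σ (Fin (P * M)) λ w₁ → Σ (Fin (P * M)) λ w₂ →
    OutsideNbr x w₁ × OutsideNbr x w₂ × (copyOf w₁ ≢ copyOf w₂) ×
    (∀ w → OutsideNbr x w → (w ≡ w₁) ⊎ (w ≡ w₂))

  edgesBetween : Fin P → Fin P → ℕ
  edgesBetween i j = sumF λ u → count λ v → adj Gt (combine {P} i u) (combine {P} j v)

record RecFamily (r a : ℕ) (p : ℕ → ℕ) (n : ℕ)
                 (G : (t : ℕ) → Graph (Size a p t)) : Set where
  field
    r≥1    : 1 ≤ r
    a≥1    : 1 ≤ a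
    p-pos  : ∀ t → 2 ≤ t → 1 ≤ p t
    G₁-reg  : Regular r (G 1)
    G₁-conn : KConnected r (G 1)
    copies : ∀ k → suc (suc k) ≤ n →
      PartsAreCopies (p (suc (suc k))) (Size a p (suc k)) (G (suc (suc k))) (G (suc k))
    outside : ∀ k → suc (suc k) ≤ n →
      TwoOutside (p (suc (suc k))) (Size a p (suc k)) (G (suc (suc k))) (G (suc k))
    uniform : ∀ k → suc (suc k) ≤ n → ∃ λ e →
      (∀ i j → i ≢ j → edgesBetween (p (suc (suc k))) (Size a p (suc k)) (G (suc (suc k))) (G (suc k)) i j ≡ e) ×
      (r + 2 * k + 2 ≤ e)
    r+2k≥4 : ∀ k → suc (suc k) ≤ n → 4 ≤ r + 2 * k
    Gt-reg  : ∀ k → suc (suc k) ≤ n → Regular (r + 2 * suc k) (G (suc (suc k)))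
    Gt-conn : ∀ k → suc (suc k) ≤ n → KConnected (r + 2 * suc k) (G (suc (suc k)))

module Submission where

-- Let H be the union of the copies G_{n-1}^i, i ∈ I, inside
-- G_n = G_{n-1}^1 ⊕ ⋯ ⊕ G_{n-1}^{p_n}, and let S be a set of fewer than
-- κ = r + 2(n-2) deleted vertices.  Every copy is κ-connected, so its
-- surviving vertices stay connected.  Between two copies i ≠ j there are
-- e ≥ κ + 2 edges, and every vertex has at most one neighbour in any other
-- copy (it has only two outside neighbours, in different copies); hence the
-- i–j edges form a matching, deleting a vertex destroys at most one of them,
-- and since |S| < e some i–j edge survives.  So H − S is connected.

open import Defs hiding (sym)
open import Data.Nat using (ℕ; zero; suc; _+_; _*_; _∸_; _≤_; _<_; z≤n; s≤s)
open import Data.Nat.Properties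
  using (+-mono-≤; +-monoʳ-≤; +-comm; +-assoc; +-identityʳ; *-zeroʳ; *-identityˡ; *-distribˡ-+;
         ≤-refl; ≤-reflexive; ≤-trans; <-≤-trans; ≤-<-trans; <-irrefl; m≤m+n; m≤n+m; n≤1+n;
         +-commutativeSemigroup; module ≤-Reasoning)
open import Algebra.Properties.CommutativeSemigroup +-commutativeSemigroup using (interchange)
open import Data.Bool using (Bool; true; false; _∧_; not; T; if_then_else_)
open import Data.Bool.Properties using (T-∧; T-≡)
open import Data.Fin using (Fin; zero; suc; quotient; remainder; combine; _↑ˡ_; _↑ʳ_; _≟_)
open import Data.Fin.Properties using (suc-injective; remQuot-combine; combine-remQuot; combine-injectiveʳ)
open import Data.Product using (∃; _×_; _,_; proj₁; proj₂)
open import Data.Sum using (inj₁; inj₂)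
open import Data.Empty using (⊥-elim)
open import Function.Bundles using (Equivalence)
open import Relation.Nullary using (yes; no)
open import Relation.Binary.PropositionalEquality

sumF-cong : ∀ {n} {f g : Fin n → ℕ} → (∀ x → f x ≡ g x) → sumF f ≡ sumF g
sumF-cong {zero}  f≡g = refl
sumF-cong {suc n} f≡g = cong₂ _+_ (f≡g zero) (sumF-cong (λ x → f≡g (suc x)))

sumF-mono : ∀ {n} {f g : Fin n → ℕ} → (∀ x → f x ≤ g x) → sumF f ≤ sumF g
sumF-mono {zero}  f≤g = z≤n
sumF-mono {suc n} f≤g = +-mono-≤ (f≤g zero) (sumF-mono (λ x → f≤g (suc x)))

sumF-0 : ∀ n → sumF {n} (λ _ → 0) ≡ 0
sumF-0 zero    = refl
sumF-0 (suc n) = sumF-0 n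

sumF-+ : ∀ {n} (f g : Fin n → ℕ) → sumF (λ x → f x + g x) ≡ sumF f + sumF g
sumF-+ {zero}  f g = refl
sumF-+ {suc n} f g =
  trans (cong (f zero + g zero +_) (sumF-+ (λ x → f (suc x)) (λ x → g (suc x))))
        (interchange (f zero) (g zero) (sumF (λ x → f (suc x))) (sumF (λ x → g (suc x))))

sumF²-+ : ∀ {m n} (f g : Fin m → Fin n → ℕ) →
  sumF (λ u → sumF (λ v → f u v + g u v)) ≡
  sumF (λ u → sumF (f u)) + sumF (λ u → sumF (g u))
sumF²-+ f g = trans (sumF-cong (λ u → sumF-+ (f u) (g u))) (sumF-+ (λ u → sumF (f u)) (λ u → sumF (g u)))

sumF-* : ∀ {n} (c : ℕ) (f : Fin n → ℕ) → sumF (λ x → c * f x) ≡ c * sumF f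
sumF-* {zero}  c f = sym (*-zeroʳ c)
sumF-* {suc n} c f =
  trans (cong (c * f zero +_) (sumF-* c (λ x → f (suc x))))
        (sym (*-distribˡ-+ c (f zero) (sumF (λ x → f (suc x)))))

sumF-swap : ∀ {m n} (h : Fin m → Fin n → ℕ) →
  sumF (λ u → sumF (h u)) ≡ sumF (λ v → sumF (λ u → h u v))
sumF-swap {zero}  {n} h = sym (sumF-0 n)
sumF-swap {suc m} {n} h =
  trans (cong (sumF (h zero) +_) (sumF-swap (λ u → h (suc u))))
        (sym (sumF-+ (h zero) (λ v → sumF (λ u → h (suc u) v))))

sumF-witness : ∀ {n} (f : Fin n → ℕ) → 1 ≤ sumF f → ∃ λ x → 1 ≤ f x
sumF-witness {suc n} f pos with f zero in f0
... | suc _ = zero , subst (1 ≤_) (sym f0) (s≤s z≤n)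
... | zero  with x , fx≥1 ← sumF-witness (λ x → f (suc x)) pos = suc x , fx≥1

sumF-term : ∀ {n} (f : Fin n → ℕ) (i : Fin n) → f i ≤ sumF f
sumF-term f zero    = m≤m+n _ _
sumF-term f (suc i) = ≤-trans (sumF-term (λ x → f (suc x)) i) (m≤n+m _ _)

sumF-two-terms : ∀ {n} (f : Fin n → ℕ) (i j : Fin n) → i ≢ j → f i + f j ≤ sumF f
sumF-two-terms f zero    zero    i≢j = ⊥-elim (i≢j refl)
sumF-two-terms f zero    (suc j) i≢j = +-monoʳ-≤ (f zero) (sumF-term (λ x → f (suc x)) j)
sumF-two-terms f (suc i) zero    i≢j =
  subst (_≤ sumF f) (+-comm (f zero) (f (suc i)))
        (+-monoʳ-≤ (f zero) (sumF-term (λ x → f (suc x)) i))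
sumF-two-terms f (suc i) (suc j) i≢j =
  ≤-trans (sumF-two-terms (λ x → f (suc x)) i j (λ i≡j → i≢j (cong suc i≡j))) (m≤n+m _ _)

sumF-↑ : ∀ m n (f : Fin (m + n) → ℕ) →
  sumF f ≡ sumF (λ i → f (i ↑ˡ n)) + sumF (λ j → f (m ↑ʳ j))
sumF-↑ zero    n f = refl
sumF-↑ (suc m) n f =
  trans (cong (f zero +_) (sumF-↑ m n (λ x → f (suc x)))) (sym (+-assoc (f zero) _ _))

sumF-combine : ∀ m n (f : Fin (m * n) → ℕ) →
  sumF f ≡ sumF {m} (λ i → sumF {n} (λ u → f (combine i u)))
sumF-combine zero    n f = refl
sumF-combine (suc m) n f =
  trans (sumF-↑ n (m * n) f)
        (cong (sumF (λ u → f (u ↑ˡ (m * n))) +_) (sumF-combine m n (λ j → f (n ↑ʳ j))))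

⟦_⟧ : Bool → ℕ
⟦ x ⟧ = if x then 1 else 0

⟦⟧-positive : ∀ x → 1 ≤ ⟦ x ⟧ → T x
⟦⟧-positive true _ = _

count-none : ∀ {n} (F : Fin n → Bool) → (∀ x → F x ≡ false) → count F ≡ 0
count-none {n} F none = trans (sumF-cong (λ x → cong ⟦_⟧ (none x))) (sumF-0 n)

count-≤1 : ∀ {n} (F : Fin n → Bool) → (∀ x y → T (F x) → T (F y) → x ≡ y) → count F ≤ 1
count-≤1 {zero}  F unique = z≤n
count-≤1 {suc n} F unique with F zero in F0
... | true  = ≤-reflexive (cong suc (count-none (λ x → F (suc x)) others))
  where
  others : ∀ x → F (suc x) ≡ false
  others x with F (suc x) in F1
  ... | false = refl
  ... | true with () ← unique (suc x) zero (Equivalence.from T-≡ F1) (Equivalence.from T-≡ F0)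
... | false = count-≤1 (λ x → F (suc x)) (λ x y Fx Fy → suc-injective (unique _ _ Fx Fy))

-- Let A be a 0/1 matrix with at most one 1 in every row and
-- column (a matching between Fin m and Fin n).

module Matching {m n : ℕ} (A : Fin m → Fin n → Bool)
                (row≤1 : ∀ u → count (A u) ≤ 1)
                (col≤1 : ∀ v → count (λ u → A u v) ≤ 1) where

  size : ℕ
  size = sumF (λ u → count (A u))

  surviving : (Fin m → Bool) → (Fin n → Bool) → ℕ
  surviving s t = sumF λ u → count λ v → A u v ∧ not (s u) ∧ not (t v)

  -- An entry is either surviving or hit by a deleted row or column.
  entry-cover : ∀ a x y → ⟦ a ⟧ ≤ ⟦ a ∧ not x ∧ not y ⟧ + (⟦ x ⟧ * ⟦ a ⟧ + ⟦ y ⟧ * ⟦ a ⟧)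
  entry-cover false x     y     = z≤n
  entry-cover true  true  y     = s≤s z≤n
  entry-cover true  false true  = s≤s z≤n
  entry-cover true  false false = s≤s z≤n

  sparse-line : ∀ x k → k ≤ 1 → ⟦ x ⟧ * k ≤ ⟦ x ⟧
  sparse-line false k k≤1 = z≤n
  sparse-line true  k k≤1 = ≤-trans (≤-reflexive (*-identityˡ k)) k≤1

  rows-hit : (s : Fin m → Bool) → sumF (λ u → sumF (λ v → ⟦ s u ⟧ * ⟦ A u v ⟧)) ≤ count s
  rows-hit s = sumF-mono λ u →
    ≤-trans (≤-reflexive (sumF-* ⟦ s u ⟧ (λ v → ⟦ A u v ⟧))) (sparse-line (s u) _ (row≤1 u))

  cols-hit : (t : Fin n → Bool) → sumF (λ u → sumF (λ v → ⟦ t v ⟧ * ⟦ A u v ⟧)) ≤ count t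
  cols-hit t = ≤-trans (≤-reflexive (sumF-swap (λ u v → ⟦ t v ⟧ * ⟦ A u v ⟧))) (sumF-mono λ v →
    ≤-trans (≤-reflexive (sumF-* ⟦ t v ⟧ (λ u → ⟦ A u v ⟧))) (sparse-line (t v) _ (col≤1 v)))

  deletion-bound : (s : Fin m → Bool) (t : Fin n → Bool) →
    size ≤ surviving s t + (count s + count t)
  deletion-bound s t = begin
    size
      ≤⟨ sumF-mono (λ u → sumF-mono (λ v → entry-cover (A u v) (s u) (t v))) ⟩
    sumF (λ u → sumF (λ v → ⟦ A u v ∧ not (s u) ∧ not (t v) ⟧ + (hitS u v + hitT u v)))
      ≡⟨ trans (sumF²-+ (λ u v → ⟦ A u v ∧ not (s u) ∧ not (t v) ⟧) (λ u v → hitS u v + hitT u v))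
               (cong (surviving s t +_) (sumF²-+ hitS hitT)) ⟩
    surviving s t + (sumF (λ u → sumF (hitS u)) + sumF (λ u → sumF (hitT u)))
      ≤⟨ +-monoʳ-≤ (surviving s t) (+-mono-≤ (rows-hit s) (cols-hit t)) ⟩
    surviving s t + (count s + count t) ∎
    where
    open ≤-Reasoning
    hitS hitT : Fin m → Fin n → ℕ
    hitS u v = ⟦ s u ⟧ * ⟦ A u v ⟧
    hitT u v = ⟦ t v ⟧ * ⟦ A u v ⟧

  some-survive : (s : Fin m → Bool) (t : Fin n → Bool) → count s + count t < size →
    1 ≤ surviving s t
  some-survive s t deleted<size = positive (deletion-bound s t)
    where
    positive : ∀ {g} → size ≤ g + (count s + count t) → 1 ≤ g
    positive {zero}  size≤deleted = ⊥-elim (<-irrefl refl (<-≤-trans deleted<size size≤deleted))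
    positive {suc g} _            = s≤s z≤n

  surviving-entry : (s : Fin m → Bool) (t : Fin n → Bool) → count s + count t < size →
    ∃ λ u → ∃ λ v → T (A u v) × T (not (s u)) × T (not (t v))
  surviving-entry s t deleted<size
    with u , pos-u ← sumF-witness _ (some-survive s t deleted<size)
    with v , pos-v ← sumF-witness _ pos-u
    with Auv , kept ← Equivalence.to T-∧ (⟦⟧-positive _ pos-v)
    = u , v , Auv , Equivalence.to T-∧ kept

walk-++ : ∀ {N} {G : Graph N} {W} {u v w} → Walk G W u v → Walk G W v w → Walk G W u w
walk-++ (here u _)           q = q
walk-++ (step u v _ Wu uv p) q = step u v _ Wu uv (walk-++ p q)

walk-map : ∀ {N N'} {G : Graph N} {G' : Graph N'} {W W'} (h : Fin N → Fin N') →
  (∀ x y → adj G x y ≡ adj G' (h x) (h y)) → (∀ z → T (W z) → T (W' (h z))) →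
  ∀ {u v} → Walk G W u v → Walk G' W' (h u) (h v)
walk-map h adj-h W-h (here u Wu)           = here (h u) (W-h u Wu)
walk-map h adj-h W-h (step u v w Wu uv p) =
  step (h u) (h v) (h w) (W-h u Wu) (subst T (adj-h u v) uv) (walk-map h adj-h W-h p)

module CopyUnion (P M : ℕ) (Gt : Graph (P * M)) (Gp : Graph M)
                 (copies : PartsAreCopies P M Gt Gp) (outside : TwoOutside P M Gt Gp)
                 (κ e : ℕ) (Gp-conn : KConnected κ Gp)
                 (uniform : ∀ i j → i ≢ j → edgesBetween P M Gt Gp i j ≡ e) (κ≤e : κ ≤ e) where

  c : Fin P → Fin M → Fin (P * M)
  c = combine {P} {M}

  q : Fin (P * M) → Fin P
  q = quotient {P} M

  q-c : ∀ i u → q (c i u) ≡ i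
  q-c i u = cong proj₁ (remQuot-combine {P} {M} i u)

  c-q : ∀ x → c (q x) (remainder {P} M x) ≡ x
  c-q x = combine-remQuot {P} M x

  one-neighbour-per-copy : ∀ i j → i ≢ j → ∀ u → count (λ v → adj Gt (c i u) (c j v)) ≤ 1
  one-neighbour-per-copy i j i≢j u = count-≤1 _ unique
    where
    outsideNbr : ∀ v → T (adj Gt (c i u) (c j v)) → OutsideNbr P M Gt Gp (c i u) (c j v)
    outsideNbr v uv = uv , λ same → i≢j (trans (sym (q-c i u)) (trans (sym same) (q-c j v)))
    unique : ∀ v v' → T (adj Gt (c i u) (c j v)) → T (adj Gt (c i u) (c j v')) → v ≡ v'
    unique v v' uv uv'
      with w₁ , w₂ , _ , _ , w₁≁w₂ , onlyTwo ← outside (c i u)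
      with onlyTwo (c j v) (outsideNbr v uv) | onlyTwo (c j v') (outsideNbr v' uv')
    ... | inj₁ e₁ | inj₁ e₁' = combine-injectiveʳ j v j v' (trans e₁ (sym e₁'))
    ... | inj₂ e₂ | inj₂ e₂' = combine-injectiveʳ j v j v' (trans e₂ (sym e₂'))
    ... | inj₁ e₁ | inj₂ e₂' = ⊥-elim (w₁≁w₂ (trans (cong q (sym e₁)) (trans (q-c j v)
                                  (sym (trans (cong q (sym e₂')) (q-c j v'))))))
    ... | inj₂ e₂ | inj₁ e₁' = ⊥-elim (w₁≁w₂ (trans (cong q (sym e₁')) (trans (q-c j v')
                                  (sym (trans (cong q (sym e₂)) (q-c j v))))))

  module Deleted (I : Fin P → Bool) (S : Fin (P * M) → Bool) (|S|<κ : count S < κ) where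

    Remaining : Fin (P * M) → Bool
    Remaining x = I (q x) ∧ not (S x)

    deletedIn : Fin P → ℕ
    deletedIn i = count (λ u → S (c i u))

    |S|-by-copy : count S ≡ sumF deletedIn
    |S|-by-copy = sumF-combine P M (λ x → ⟦ S x ⟧)

    remaining : ∀ {i u} → T (I i) → T (not (S (c i u))) → T (Remaining (c i u))
    remaining {i} {u} Ii kept rewrite q-c i u = Equivalence.from T-∧ (Ii , kept)

    within-copy : ∀ i → T (I i) → ∀ x y → T (not (S (c i x))) → T (not (S (c i y))) →
                  Walk Gt Remaining (c i x) (c i y)
    within-copy i Ii x y kx ky =
      walk-map (c i) (λ u v → sym (copies i u v)) (λ _ → remaining Ii)
        (proj₂ Gp-conn (λ u → S (c i u)) fewer x y kx ky)
      where
      fewer : deletedIn i < κ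
      fewer = ≤-<-trans (subst (deletedIn i ≤_) (sym |S|-by-copy) (sumF-term deletedIn i)) |S|<κ

    crossing-edge : ∀ i j → i ≢ j → ∃ λ x → ∃ λ y →
      T (adj Gt (c i x) (c j y)) × T (not (S (c i x))) × T (not (S (c j y)))
    crossing-edge i j i≢j =
      surviving-entry (λ u → S (c i u)) (λ v → S (c j v)) (begin-strict
        deletedIn i + deletedIn j ≤⟨ subst (deletedIn i + deletedIn j ≤_) (sym |S|-by-copy) (sumF-two-terms deletedIn i j i≢j) ⟩
        count S                   <⟨ <-≤-trans |S|<κ κ≤e ⟩
        e                         ≡⟨ sym (uniform i j i≢j) ⟩
        size                      ∎)
      where
      open ≤-Reasoning
      column≤1 : ∀ v → count (λ u → adj Gt (c i u) (c j v)) ≤ 1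
      column≤1 v = subst (_≤ 1) (sumF-cong (λ u → cong ⟦_⟧ (Graph.sym Gt (c j v) (c i u))))
                         (one-neighbour-per-copy j i (λ j≡i → i≢j (sym j≡i)) v)
      open Matching (λ u v → adj Gt (c i u) (c j v)) (one-neighbour-per-copy i j i≢j) column≤1

    walk-between-copies : ∀ i x j y → T (Remaining (c i x)) → T (Remaining (c j y)) →
                          Walk Gt Remaining (c i x) (c j y)
    walk-between-copies i x j y rx ry
      with Iqx , kx ← Equivalence.to T-∧ rx | Iqy , ky ← Equivalence.to T-∧ ry
      with Ii ← subst (λ z → T (I z)) (q-c i x) Iqx | Ij ← subst (λ z → T (I z)) (q-c j y) Iqy
      with i ≟ j
    ... | yes refl = within-copy i Ii x y kx ky
    ... | no i≢j with x' , y' , x'y' , kx' , ky' ← crossing-edge i j i≢j =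
      walk-++ (within-copy i Ii x x' kx kx')
              (step (c i x') (c j y') (c j y) (remaining Ii kx') x'y' (within-copy j Ij y' y ky' ky))

    connected : ConnectedOn Gt Remaining
    connected u v ru rv =
      subst₂ (Walk Gt Remaining) (c-q u) (c-q v)
        (walk-between-copies (q u) (remainder {P} M u) (q v) (remainder {P} M v)
          (subst (λ z → T (Remaining z)) (sym (c-q u)) ru)
          (subst (λ z → T (Remaining z)) (sym (c-q v)) rv))

  copy-in-union : ∀ (I : Fin P → Bool) i → T (I i) → count (allV {M}) ≤ count (λ w → I (q w))
  copy-in-union I i Ii = begin
    count (allV {M})                        ≡⟨ sumF-cong (λ u → cong ⟦_⟧ (sym (Iqcu≡true {u}))) ⟩
    sumF (λ u → ⟦ I (q (c i u)) ⟧)          ≤⟨ sumF-term (λ i → sumF (λ u → ⟦ I (q (c i u)) ⟧)) i ⟩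
    sumF (λ i → sumF (λ u → ⟦ I (q (c i u)) ⟧)) ≡⟨ sym (sumF-combine P M (λ w → ⟦ I (q w) ⟧)) ⟩
    count (λ w → I (q w))                   ∎
    where
    open ≤-Reasoning
    Iqcu≡true : ∀ {u} → I (q (c i u)) ≡ true
    Iqcu≡true {u} = trans (cong I (q-c i u)) (Equivalence.to T-≡ Ii)

  union-kConnected : ∀ (I : Fin P → Bool) → 1 ≤ count I → KConnectedOn κ Gt (λ w → I (q w))
  union-kConnected I nonempty with i , Ii≥1 ← sumF-witness _ nonempty =
    <-≤-trans (proj₁ Gp-conn) (copy-in-union I i (⟦⟧-positive (I i) Ii≥1)) ,
    λ S |S|<κ → Deleted.connected I S |S|<κ

previous-level-connected : ∀ r a p k (G : (t : ℕ) → Graph (Size a p t)) →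
  RecFamily r a p (suc (suc k)) G → KConnected (r + 2 * k) (G (suc k))
previous-level-connected r a p zero    G RF =
  subst (λ κ → KConnected κ (G 1)) (sym (+-identityʳ r)) (RecFamily.G₁-conn RF)
previous-level-connected r a p (suc k) G RF = RecFamily.Gt-conn RF k (n≤1+n _)

-- The theorem: apply CopyUnion at level n = k + 2 with κ = r + 2k.
lemma13 : (r a : ℕ) (p : ℕ → ℕ) (k : ℕ)
          (G : (t : ℕ) → Graph (Size a p t)) →
          RecFamily r a p (suc (suc k)) G →
          (l : ℕ) → 2 ≤ l → l ≤ p (suc (suc k)) ∸ 1 →
          (I : Fin (p (suc (suc k))) → Bool) → count I ≡ l →
          KConnectedOn (r + 2 * k) (G (suc (suc k)))
            (λ w → I (quotient {p (suc (suc k))} (Size a p (suc k)) w))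
lemma13 r a p k G RF l l≥2 _ I |I|≡l
  with e , uniform , e≥κ+2 ← RecFamily.uniform RF k ≤-refl =
  CopyUnion.union-kConnected (p (suc (suc k))) (Size a p (suc k)) (G (suc (suc k))) (G (suc k))
    (RecFamily.copies RF k ≤-refl) (RecFamily.outside RF k ≤-refl)
    (r + 2 * k) e (previous-level-connected r a p k G RF)
    uniform (≤-trans (m≤m+n (r + 2 * k) 2) e≥κ+2)
    I (subst (1 ≤_) (sym |I|≡l) (≤-trans (n≤1+n 1) l≥2))
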